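{- Let $n\ge k$ and $1\le t\le k-2$ be integers, and let \[ J_t(n,k):=\left\{A\in \binom{[n]}{k}:|A\cap [t+2]|\ge t+1\right\}. \] Then \[ \Phi_{n,k}(J_t(n,k)) \ge 1+\frac{(n-k)\bigl((k-t)(t+1)-(n-k)\bigr)}{(n-t)(n-t-1)}. \] In particular, if $k<n<k+(k-t)(t+1)$, then $\Phi_{n,k}(J_t(n,k))>1$.
   Context: $\binom{[n]}{k}$ denotes the family of all $k$-element subsets of $[n]$. For $\mathcal{F}\subseteq\binom{[n]}{k}$ and $A\in\mathcal{F}$, $i_{\mathcal{F}}(A):=\min_{B\in\mathcal{F}}|A\cap B|$, and $\Phi_{n,k}(\mathcal{F}):=\sum_{A\in \mathcal{F}}\binom{n-i_{\mathcal{F}}(A)}{k-i_{\mathcal{F}}(A)}^{ -1}$. -}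

module Defs where

open import Data.Bool using (Bool; true; false; _∧_)
open import Data.Nat using (ℕ; zero; suc; _+_; _*_; _∸_; _⊓_; _≡ᵇ_; _<ᵇ_)
open import Data.Nat.Combinatorics using (_C_)
open import Data.Integer using (ℤ; +_)
open import Data.Fin using (Fin; toℕ)
open import Data.Fin.Subset using (Subset; _∩_; ∣_∣)
open import Data.List using (List; []; _∷_; map; _++_; filter; foldr)
open import Data.Vec using (_∷_; []; tabulate)
open import Data.Rational using (ℚ; 0ℚ; _/_) renaming (_+_ to _+ℚ_)
open import Relation.Nullary.Decidable using (Dec)
open import Data.Bool.Properties using (T?)
open import Data.Bool using (T)

allSubsets : (n : ℕ) → List (Subset n)
allSubsets zero = [] ∷ []
allSubsets (suc n) = map (true ∷_) (allSubsets n) ++ map (false ∷_) (allSubsets n)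

-- A family of subsets of [n], given as a (duplicate-free) list.
Family : ℕ → Set
Family n = List (Subset n)

-- [m] ∩ [n] as a subset of [n] (elements 0..m-1 of Fin n, i.e. 1..m).
initSeg : (n m : ℕ) → Subset n
initSeg n m = tabulate (λ i → toℕ i <ᵇ m)

J : (n k t : ℕ) → Family n
J n k t = filter (λ A → T? ((∣ A ∣ ≡ᵇ k) ∧ (t <ᵇ ∣ A ∩ initSeg n (t + 2) ∣)))
                 (allSubsets n)

-- i_F(A) = min_{B ∈ F} |A ∩ B|  (the default value n is only used for empty F,
-- and is harmless since |A ∩ B| ≤ n always).
iF : {n : ℕ} → Family n → Subset n → ℕ
iF {n} F A = foldr (λ B r → ∣ A ∩ B ∣ ⊓ r) n F

-- 1/m as a rational; the value at 0 is a convention (never used in the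
-- statement since the relevant binomials / denominators are positive).
inv : ℕ → ℚ
inv zero = 0ℚ
inv (suc m) = (+ 1) / suc m

Φ : (n k : ℕ) → Family n → ℚ
Φ n k F = foldr (λ A r → inv ((n ∸ iF F A) C (k ∸ iF F A)) +ℚ r) 0ℚ F

-- Write a(A) = |A ∩ [t+2]|. For A, B ∈ J_t(n,k), counting inside [t+2] gives
-- |A ∩ B| ≥ a(A) + a(B) − (t+2) ≥ a(A) − 1, so i(A) ≥ a(A) − 1, and since
-- C(n−i, k−i) decreases in i, the summand of Φ at A is at least
-- 1 / C(n−a(A)+1, k−a(A)+1). Every member of J has a(A) ∈ {t+1, t+2}: there are
-- C(n−t−2, k−t−2) members with a(A) = t+2 and (t+2)·C(n−t−2, k−t−1) with a(A) = t+1.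
-- By the absorption identity k·C(n,k) = n·C(n−1,k−1) this lower bound for Φ
-- is exactly the right-hand side.

module Submission where

open import Defs
open import Data.Nat using (ℕ; _+_; _*_; _∸_; _≤_; _<_)
open import Data.Integer using (+_) renaming (_*_ to _*ℤ_; _-_ to _-ℤ_)
open import Data.Rational using (ℚ; 1ℚ; _/_) renaming (_+_ to _+ℚ_; _*_ to _*ℚ_; _≤_ to _≤ℚ_; _<_ to _<ℚ_)
open import Data.Product using (_×_)

open import Algebra.Bundles using (CommutativeMonoid)
open import Data.Bool using (Bool; true; false; _∧_; if_then_else_; T)
open import Data.Bool.Properties using (T?; T-∧; ∧-zeroʳ)
open import Data.Fin.Subset using (Subset; _∩_; ∣_∣; ⊥)
open import Data.Fin.Subset.Properties using (∣p∩q∣≤∣q∣; ∣p∣≤n; ∩-zeroʳ; ∣⊥∣≡0)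
open import Data.Integer as ℤ using (ℤ)
import Data.Integer.Properties as ℤ
import Data.Integer.Tactic.RingSolver as ℤ-Solver
open import Data.List using (List; []; _∷_; map; _++_; filter; foldr)
open import Data.List.Relation.Unary.All as All using (All)
open import Data.List.Relation.Unary.All.Properties using (all-filter)
open import Data.Nat using (zero; suc; pred; NonZero; _≡ᵇ_; _<ᵇ_; z≤n; s≤s; z<s; >-nonZero)
open import Data.Nat.Combinatorics using (_C_; nC1≡n; nCn≡1; nCk≡nC[n∸k]; nCk+nC[k+1]≡[n+1]C[k+1])
open import Data.Nat.Properties
import Data.Nat.Tactic.RingSolver as ℕ-Solver
open import Data.Product using (_,_; proj₂)
open import Data.Rational using (0ℚ; fromℚᵘ; +-0-rawMonoid)
import Data.Rational.Properties as ℚ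
open import Data.Rational.Unnormalised as ℚᵘ using (mkℚᵘ; *≡*; *≤*; *<*)
import Data.Rational.Unnormalised.Properties as ℚᵘ
open import Data.Sum using (inj₁; inj₂)
open import Data.Vec using (_∷_; [])
open import Function using (_∘_)
open import Function.Bundles using (Equivalence)
open import Relation.Binary.PropositionalEquality
  using (_≡_; refl; sym; trans; cong; cong₂; subst; subst₂; module ≡-Reasoning)

open import Algebra.Definitions.RawMonoid +-0-rawMonoid using () renaming (_×_ to _×ℚ_)
open import Algebra.Properties.CommutativeSemigroup
  (CommutativeMonoid.commutativeSemigroup ℚ.+-0-commutativeMonoid) using (interchange)

nCk≤[n+1]C[k+1] : ∀ n k → n C k ≤ suc n C suc k
nCk≤[n+1]C[k+1] n k = ≤-trans (m≤m+n (n C k) (n C suc k)) (≤-reflexive (nCk+nC[k+1]≡[n+1]C[k+1] n k))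

0<nCk : ∀ {n k} → k ≤ n → 0 < n C k
0<nCk {n}     {zero}  _         = z<s
0<nCk {suc n} {suc k} (s≤s k≤n) = ≤-trans (0<nCk k≤n) (nCk≤[n+1]C[k+1] n k)

[1+n]Cn≡1+n : ∀ n → suc n C n ≡ suc n
[1+n]Cn≡1+n n = begin
  suc n C n             ≡⟨ nCk≡nC[n∸k] (n≤1+n n) ⟩
  suc n C (suc n ∸ n)   ≡⟨ cong (suc n C_) (m+n∸n≡m 1 n) ⟩
  suc n C 1             ≡⟨ nC1≡n (suc n) ⟩
  suc n                 ∎
  where open ≡-Reasoning

pred[n]Cpred[k]≤nCk : ∀ {n k} → k ≤ n → pred n C pred k ≤ n C k
pred[n]Cpred[k]≤nCk {n}     {zero}  _ = ≤-refl
pred[n]Cpred[k]≤nCk {suc n} {suc k} _ = nCk≤[n+1]C[k+1] n k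

[n∸j]C[k∸j]≤[n∸i]C[k∸i] : ∀ {n k i j} → k ≤ n → i ≤ j → (n ∸ j) C (k ∸ j) ≤ (n ∸ i) C (k ∸ i)
[n∸j]C[k∸j]≤[n∸i]C[k∸i] {j = zero} _ z≤n = ≤-refl
[n∸j]C[k∸j]≤[n∸i]C[k∸i] {n} {k} {j = suc j} k≤n i≤1+j with m≤n⇒m<n∨m≡n i≤1+j
... | inj₂ refl      = ≤-refl
... | inj₁ (s≤s i≤j) = ≤-trans step ([n∸j]C[k∸j]≤[n∸i]C[k∸i] k≤n i≤j)
  where
  step : (n ∸ suc j) C (k ∸ suc j) ≤ (n ∸ j) C (k ∸ j)
  step = subst₂ (λ a b → a C b ≤ (n ∸ j) C (k ∸ j))
                (pred[m∸n]≡m∸[1+n] n j) (pred[m∸n]≡m∸[1+n] k j)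
                (pred[n]Cpred[k]≤nCk (∸-monoˡ-≤ j k≤n))

[k+1]*[n+1]C[k+1]≡[n+1]*nCk : ∀ n k → suc k * (suc n C suc k) ≡ suc n * (n C k)
[k+1]*[n+1]C[k+1]≡[n+1]*nCk zero    zero    = refl
[k+1]*[n+1]C[k+1]≡[n+1]*nCk zero    (suc k) = *-zeroʳ (suc (suc k))
[k+1]*[n+1]C[k+1]≡[n+1]*nCk (suc n) zero    =
  trans (*-identityˡ _) (trans (nC1≡n (suc (suc n))) (sym (*-identityʳ _)))
[k+1]*[n+1]C[k+1]≡[n+1]*nCk (suc n) (suc k) = begin
  suc (suc k) * (suc (suc n) C suc (suc k))
    ≡⟨ cong (suc (suc k) *_) (sym (nCk+nC[k+1]≡[n+1]C[k+1] (suc n) (suc k))) ⟩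
  suc (suc k) * (x + y)
    ≡⟨ rearrange₁ k x y ⟩
  suc k * x + x + suc (suc k) * y
    ≡⟨ cong₂ (λ u v → u + x + v) ([k+1]*[n+1]C[k+1]≡[n+1]*nCk n k) ([k+1]*[n+1]C[k+1]≡[n+1]*nCk n (suc k)) ⟩
  suc n * (n C k) + x + suc n * (n C suc k)
    ≡⟨ rearrange₂ n x (n C k) (n C suc k) ⟩
  x + suc n * (n C k + n C suc k)
    ≡⟨ cong (λ z → x + suc n * z) (nCk+nC[k+1]≡[n+1]C[k+1] n k) ⟩
  suc (suc n) * x
    ∎
  where
  open ≡-Reasoning
  x = suc n C suc k
  y = suc n C suc (suc k)
  rearrange₁ : ∀ k x y → suc (suc k) * (x + y) ≡ suc k * x + x + suc (suc k) * y
  rearrange₁ = ℕ-Solver.solve-∀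
  rearrange₂ : ∀ n x u v → suc n * u + x + suc n * v ≡ x + suc n * (u + v)
  rearrange₂ = ℕ-Solver.solve-∀

[n+1]*nC[k+1]≡[n∸k]*[n+1]C[k+1] : ∀ n k → suc n * (n C suc k) ≡ (n ∸ k) * (suc n C suc k)
[n+1]*nC[k+1]≡[n∸k]*[n+1]C[k+1] n k = begin
  suc n * (n C suc k)
    ≡⟨ m+n∸m≡n (suc k * c) _ ⟨
  suc k * c + suc n * (n C suc k) ∸ suc k * c
    ≡⟨ cong (λ z → z + suc n * (n C suc k) ∸ suc k * c) ([k+1]*[n+1]C[k+1]≡[n+1]*nCk n k) ⟩
  suc n * (n C k) + suc n * (n C suc k) ∸ suc k * c
    ≡⟨ cong (_∸ suc k * c) (*-distribˡ-+ (suc n) (n C k) (n C suc k)) ⟨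
  suc n * (n C k + n C suc k) ∸ suc k * c
    ≡⟨ cong (λ z → suc n * z ∸ suc k * c) (nCk+nC[k+1]≡[n+1]C[k+1] n k) ⟩
  suc n * c ∸ suc k * c
    ≡⟨ *-distribʳ-∸ c (suc n) (suc k) ⟨
  (n ∸ k) * c
    ∎
  where
  open ≡-Reasoning
  c = suc n C suc k

∣p∩r∣+∣q∩r∣≤∣p∩q∣+∣r∣ : ∀ {n} (p q r : Subset n) → ∣ p ∩ r ∣ + ∣ q ∩ r ∣ ≤ ∣ p ∩ q ∣ + ∣ r ∣
∣p∩r∣+∣q∩r∣≤∣p∩q∣+∣r∣ []      []      []      = z≤n
∣p∩r∣+∣q∩r∣≤∣p∩q∣+∣r∣ (x ∷ p) (y ∷ q) (z ∷ r) = step x y z (∣p∩r∣+∣q∩r∣≤∣p∩q∣+∣r∣ p q r)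
  where
  a = ∣ p ∩ r ∣
  b = ∣ q ∩ r ∣
  c = ∣ p ∩ q ∣
  d = ∣ r ∣
  step : ∀ x y z → a + b ≤ c + d →
         ∣ (x ∷ p) ∩ (z ∷ r) ∣ + ∣ (y ∷ q) ∩ (z ∷ r) ∣ ≤ ∣ (x ∷ p) ∩ (y ∷ q) ∣ + ∣ z ∷ r ∣
  step true  true  true  h rewrite +-suc a b | +-suc c d = s≤s (s≤s h)
  step true  true  false h = m≤n⇒m≤1+n h
  step true  false true  h rewrite +-suc c d = s≤s h
  step true  false false h = h
  step false true  true  h rewrite +-suc a b | +-suc c d = s≤s h
  step false true  false h = h
  step false false true  h rewrite +-suc c d = m≤n⇒m≤1+n h
  step false false false h = h

initSeg-zero : ∀ n → initSeg n 0 ≡ ⊥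
initSeg-zero zero    = refl
initSeg-zero (suc n) = cong (false ∷_) (initSeg-zero n)

∣p∩initSeg0∣≡0 : ∀ {n} (p : Subset n) → ∣ p ∩ initSeg n 0 ∣ ≡ 0
∣p∩initSeg0∣≡0 {n} p = begin
  ∣ p ∩ initSeg n 0 ∣ ≡⟨ cong (λ s → ∣ p ∩ s ∣) (initSeg-zero n) ⟩
  ∣ p ∩ ⊥ ∣           ≡⟨ cong ∣_∣ (∩-zeroʳ p) ⟩
  ∣ ⊥ {n = n} ∣       ≡⟨ ∣⊥∣≡0 n ⟩
  0                   ∎
  where open ≡-Reasoning

∣initSeg∣≡ : ∀ {n p} → p ≤ n → ∣ initSeg n p ∣ ≡ p
∣initSeg∣≡ {n} {zero}      _         = trans (cong ∣_∣ (initSeg-zero n)) (∣⊥∣≡0 n)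
∣initSeg∣≡ {suc n} {suc p} (s≤s p≤n) = cong suc (∣initSeg∣≡ p≤n)

count : {X : Set} → (X → Bool) → List X → ℕ
count b []       = 0
count b (x ∷ xs) = if b x then suc (count b xs) else count b xs

module _ {X : Set} where

  count-++ : ∀ (b : X → Bool) xs ys → count b (xs ++ ys) ≡ count b xs + count b ys
  count-++ b []       ys = refl
  count-++ b (x ∷ xs) ys with b x
  ... | true  = cong suc (count-++ b xs ys)
  ... | false = count-++ b xs ys

  count-none : ∀ {b : X → Bool} → (∀ x → b x ≡ false) → ∀ xs → count b xs ≡ 0
  count-none never []       = refl
  count-none never (x ∷ xs) rewrite never x = count-none never xs

  count-map : ∀ {Y : Set} (b : Y → Bool) (f : X → Y) xs → count b (map f xs) ≡ count (b ∘ f) xs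
  count-map b f []       = refl
  count-map b f (x ∷ xs) with b (f x)
  ... | true  = cong suc (count-map b f xs)
  ... | false = count-map b f xs

count-allSubsets : ∀ n (b : Subset (suc n) → Bool) →
  count b (allSubsets (suc n)) ≡ count (b ∘ (true ∷_)) (allSubsets n) + count (b ∘ (false ∷_)) (allSubsets n)
count-allSubsets n b = trans (count-++ b (map (true ∷_) (allSubsets n)) (map (false ∷_) (allSubsets n)))
  (cong₂ _+_ (count-map b (true ∷_) (allSubsets n)) (count-map b (false ∷_) (allSubsets n)))

hasSizeTrace : ∀ {n} → ℕ → ℕ → ℕ → Subset n → Bool
hasSizeTrace {n} p c a A = (∣ A ∣ ≡ᵇ c) ∧ (∣ A ∩ initSeg n p ∣ ≡ᵇ a)

count-hasSizeTrace : ∀ n p a d → p ≤ n →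
  count (hasSizeTrace p (a + d) a) (allSubsets n) ≡ (p C a) * ((n ∸ p) C d)
count-hasSizeTrace n       zero    (suc a) d       _         =
  count-none (λ A → trans (cong (λ s → (∣ A ∣ ≡ᵇ suc a + d) ∧ (s ≡ᵇ suc a)) (∣p∩initSeg0∣≡0 A))
                          (∧-zeroʳ _)) (allSubsets n)
count-hasSizeTrace zero    zero    zero    zero    _         = refl
count-hasSizeTrace zero    zero    zero    (suc d) _         = refl
count-hasSizeTrace (suc n) zero    zero    zero    _         =
  trans (count-allSubsets n (hasSizeTrace 0 0 0))
        (cong₂ _+_ (count-none (λ _ → refl) (allSubsets n)) (count-hasSizeTrace n 0 0 0 z≤n))
count-hasSizeTrace (suc n) zero    zero    (suc d) _         = begin
  count (hasSizeTrace 0 (suc d) 0) (allSubsets (suc n))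
    ≡⟨ count-allSubsets n (hasSizeTrace 0 (suc d) 0) ⟩
  count (hasSizeTrace 0 d 0) (allSubsets n) + count (hasSizeTrace 0 (suc d) 0) (allSubsets n)
    ≡⟨ cong₂ _+_ (count-hasSizeTrace n 0 0 d z≤n) (count-hasSizeTrace n 0 0 (suc d) z≤n) ⟩
  1 * (n C d) + 1 * (n C suc d)
    ≡⟨ *-distribˡ-+ 1 (n C d) (n C suc d) ⟨
  1 * (n C d + n C suc d)
    ≡⟨ cong (1 *_) (nCk+nC[k+1]≡[n+1]C[k+1] n d) ⟩
  1 * (suc n C suc d)
    ∎
  where open ≡-Reasoning
count-hasSizeTrace (suc n) (suc p) zero    d       (s≤s p≤n) =
  trans (count-allSubsets n (hasSizeTrace (suc p) d 0))
        (cong₂ _+_ (count-none (λ _ → ∧-zeroʳ _) (allSubsets n)) (count-hasSizeTrace n p 0 d p≤n))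
count-hasSizeTrace (suc n) (suc p) (suc a) d       (s≤s p≤n) = begin
  count (hasSizeTrace (suc p) (suc a + d) (suc a)) (allSubsets (suc n))
    ≡⟨ count-allSubsets n (hasSizeTrace (suc p) (suc a + d) (suc a)) ⟩
  count (hasSizeTrace p (a + d) a) (allSubsets n) + count (hasSizeTrace p (suc a + d) (suc a)) (allSubsets n)
    ≡⟨ cong₂ _+_ (count-hasSizeTrace n p a d p≤n) (count-hasSizeTrace n p (suc a) d p≤n) ⟩
  (p C a) * x + (p C suc a) * x
    ≡⟨ *-distribʳ-+ x (p C a) (p C suc a) ⟨
  (p C a + p C suc a) * x
    ≡⟨ cong (_* x) (nCk+nC[k+1]≡[n+1]C[k+1] p a) ⟩
  (suc p C suc a) * x
    ∎
  where
  open ≡-Reasoning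
  x = (n ∸ p) C d

sumℚ : {X : Set} → (X → ℚ) → List X → ℚ
sumℚ f = foldr (λ x s → f x +ℚ s) 0ℚ

module _ {X : Set} where

  sumℚ-mono-≤ : ∀ {f g : X → ℚ} → (∀ x → f x ≤ℚ g x) → ∀ xs → sumℚ f xs ≤ℚ sumℚ g xs
  sumℚ-mono-≤ f≤g []       = ℚ.≤-refl
  sumℚ-mono-≤ f≤g (x ∷ xs) = ℚ.+-mono-≤ (f≤g x) (sumℚ-mono-≤ f≤g xs)

  sumℚ-cong : ∀ {f g : X → ℚ} → (∀ x → f x ≡ g x) → ∀ xs → sumℚ f xs ≡ sumℚ g xs
  sumℚ-cong f≡g []       = refl
  sumℚ-cong f≡g (x ∷ xs) = cong₂ _+ℚ_ (f≡g x) (sumℚ-cong f≡g xs)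

  sumℚ-+ : ∀ (f g : X → ℚ) xs → sumℚ (λ x → f x +ℚ g x) xs ≡ sumℚ f xs +ℚ sumℚ g xs
  sumℚ-+ f g []       = refl
  sumℚ-+ f g (x ∷ xs) = trans (cong (f x +ℚ g x +ℚ_) (sumℚ-+ f g xs)) (interchange (f x) (g x) _ _)

  sumℚ-filter : ∀ (b : X → Bool) (f : X → ℚ) xs →
    sumℚ f (filter (T? ∘ b) xs) ≡ sumℚ (λ x → if b x then f x else 0ℚ) xs
  sumℚ-filter b f []       = refl
  sumℚ-filter b f (x ∷ xs) with b x
  ... | true  = cong (f x +ℚ_) (sumℚ-filter b f xs)
  ... | false = trans (sumℚ-filter b f xs) (sym (ℚ.+-identityˡ _))

  sumℚ-indicator : ∀ (b : X → Bool) (q : ℚ) xs → sumℚ (λ x → if b x then q else 0ℚ) xs ≡ count b xs ×ℚ q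
  sumℚ-indicator b q []       = refl
  sumℚ-indicator b q (x ∷ xs) with b x
  ... | true  = cong (q +ℚ_) (sumℚ-indicator b q xs)
  ... | false = trans (ℚ.+-identityˡ _) (sumℚ-indicator b q xs)

t<ᵇa-split : ∀ (w : ℕ → ℚ) t {a} → a ≤ 2 + t →
  (if t <ᵇ a then w a else 0ℚ)
    ≡ (if a ≡ᵇ 2 + t then w (2 + t) else 0ℚ) +ℚ (if a ≡ᵇ 1 + t then w (1 + t) else 0ℚ)
t<ᵇa-split w zero    {0}     _         = refl
t<ᵇa-split w zero    {1}     _         = sym (ℚ.+-identityˡ (w 1))
t<ᵇa-split w zero    {2}     _         = sym (ℚ.+-identityʳ (w 2))
t<ᵇa-split w zero    {suc (suc (suc _))} (s≤s (s≤s ()))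
t<ᵇa-split w (suc t) {zero}  _         = refl
t<ᵇa-split w (suc t) {suc a} (s≤s a≤) = t<ᵇa-split (w ∘ suc) t a≤

sumℚ-filter-top-two : ∀ {X : Set} (p : X → Bool) (a : X → ℕ) (w : ℕ → ℚ) t → (∀ x → a x ≤ 2 + t) → ∀ xs →
  sumℚ (w ∘ a) (filter (λ x → T? (p x ∧ (t <ᵇ a x))) xs)
    ≡ count (λ x → p x ∧ (a x ≡ᵇ 2 + t)) xs ×ℚ w (2 + t) +ℚ count (λ x → p x ∧ (a x ≡ᵇ 1 + t)) xs ×ℚ w (1 + t)
sumℚ-filter-top-two {X} p a w t a≤2+t xs = begin
  sumℚ (w ∘ a) (filter (λ x → T? (p x ∧ (t <ᵇ a x))) xs)
    ≡⟨ sumℚ-filter (λ x → p x ∧ (t <ᵇ a x)) (w ∘ a) xs ⟩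
  sumℚ (λ x → if p x ∧ (t <ᵇ a x) then w (a x) else 0ℚ) xs
    ≡⟨ sumℚ-cong split xs ⟩
  sumℚ (λ x → top x +ℚ next x) xs
    ≡⟨ sumℚ-+ top next xs ⟩
  sumℚ top xs +ℚ sumℚ next xs
    ≡⟨ cong₂ _+ℚ_ (sumℚ-indicator (λ x → p x ∧ (a x ≡ᵇ 2 + t)) (w (2 + t)) xs)
                  (sumℚ-indicator (λ x → p x ∧ (a x ≡ᵇ 1 + t)) (w (1 + t)) xs) ⟩
  count (λ x → p x ∧ (a x ≡ᵇ 2 + t)) xs ×ℚ w (2 + t) +ℚ count (λ x → p x ∧ (a x ≡ᵇ 1 + t)) xs ×ℚ w (1 + t)
    ∎
  where
  open ≡-Reasoning
  top next : X → ℚ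
  top  x = if p x ∧ (a x ≡ᵇ 2 + t) then w (2 + t) else 0ℚ
  next x = if p x ∧ (a x ≡ᵇ 1 + t) then w (1 + t) else 0ℚ
  split : ∀ x → (if p x ∧ (t <ᵇ a x) then w (a x) else 0ℚ) ≡ top x +ℚ next x
  split x with p x
  ... | true  = t<ᵇa-split w t (a≤2+t x)
  ... | false = refl

fromℚᵘ-homo-+ : ∀ p q → fromℚᵘ (p ℚᵘ.+ q) ≡ fromℚᵘ p +ℚ fromℚᵘ q
fromℚᵘ-homo-+ p q = trans
  (ℚ.fromℚᵘ-cong (ℚᵘ.≃-sym (ℚᵘ.≃-trans (ℚ.toℚᵘ-homo-+ (fromℚᵘ p) (fromℚᵘ q))
                                       (ℚᵘ.+-cong (ℚ.toℚᵘ-fromℚᵘ p) (ℚ.toℚᵘ-fromℚᵘ q)))))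
  (ℚ.fromℚᵘ-toℚᵘ _)

fromℚᵘ-homo-* : ∀ p q → fromℚᵘ (p ℚᵘ.* q) ≡ fromℚᵘ p *ℚ fromℚᵘ q
fromℚᵘ-homo-* p q = trans
  (ℚ.fromℚᵘ-cong (ℚᵘ.≃-sym (ℚᵘ.≃-trans (ℚ.toℚᵘ-homo-* (fromℚᵘ p) (fromℚᵘ q))
                                       (ℚᵘ.*-cong (ℚ.toℚᵘ-fromℚᵘ p) (ℚ.toℚᵘ-fromℚᵘ q)))))
  (ℚ.fromℚᵘ-toℚᵘ _)

fromℚᵘ-mono-≤ : ∀ {p q} → p ℚᵘ.≤ q → fromℚᵘ p ≤ℚ fromℚᵘ q
fromℚᵘ-mono-≤ {p} {q} p≤q = ℚ.toℚᵘ-cancel-≤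
  (ℚᵘ.≤-respʳ-≃ (ℚᵘ.≃-sym (ℚ.toℚᵘ-fromℚᵘ q)) (ℚᵘ.≤-respˡ-≃ (ℚᵘ.≃-sym (ℚ.toℚᵘ-fromℚᵘ p)) p≤q))

fromℚᵘ-mono-< : ∀ {p q} → p ℚᵘ.< q → fromℚᵘ p <ℚ fromℚᵘ q
fromℚᵘ-mono-< {p} {q} p<q = ℚ.toℚᵘ-cancel-<
  (ℚᵘ.<-respʳ-≃ (ℚᵘ.≃-sym (ℚ.toℚᵘ-fromℚᵘ q)) (ℚᵘ.<-respˡ-≃ (ℚᵘ.≃-sym (ℚ.toℚᵘ-fromℚᵘ p)) p<q))

/-cong-cross : ∀ {a b c d} .{{_ : NonZero c}} .{{_ : NonZero d}} → a * d ≡ b * c → + a / c ≡ + b / d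
/-cong-cross {a} {b} {suc c} {suc d} eq =
  ℚ.fromℚᵘ-cong {mkℚᵘ (+ a) c} {mkℚᵘ (+ b) d}
    (*≡* (trans (sym (ℤ.pos-* a (suc d))) (trans (cong +_ eq) (ℤ.pos-* b (suc c)))))

/-≤-cross : ∀ {a b c d} .{{_ : NonZero c}} .{{_ : NonZero d}} → a * d ≤ b * c → + a / c ≤ℚ + b / d
/-≤-cross {a} {b} {suc c} {suc d} le =
  fromℚᵘ-mono-≤ {mkℚᵘ (+ a) c} {mkℚᵘ (+ b) d}
    (*≤* (subst₂ ℤ._≤_ (ℤ.pos-* a (suc d)) (ℤ.pos-* b (suc c)) (ℤ.+≤+ le)))

/-<-cross : ∀ {a b c d} .{{_ : NonZero c}} .{{_ : NonZero d}} → a * d < b * c → + a / c <ℚ + b / d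
/-<-cross {a} {b} {suc c} {suc d} lt =
  fromℚᵘ-mono-< {mkℚᵘ (+ a) c} {mkℚᵘ (+ b) d}
    (*<* (subst₂ ℤ._<_ (ℤ.pos-* a (suc d)) (ℤ.pos-* b (suc c)) (ℤ.+<+ lt)))

+-distrib-/ : ∀ a b c .{{_ : NonZero c}} → + (a + b) / c ≡ + a / c +ℚ + b / c
+-distrib-/ a b (suc c) = trans
  (ℚ.fromℚᵘ-cong {mkℚᵘ (+ (a + b)) c} {mkℚᵘ (+ a) c ℚᵘ.+ mkℚᵘ (+ b) c} (*≡* cross))
  (fromℚᵘ-homo-+ (mkℚᵘ (+ a) c) (mkℚᵘ (+ b) c))
  where
  s = + suc c
  cross : + (a + b) ℤ.* (s ℤ.* s) ≡ (+ a ℤ.* s ℤ.+ + b ℤ.* s) ℤ.* s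
  cross = trans (cong (ℤ._* (s ℤ.* s)) (ℤ.pos-+ a b)) (distrib (+ a) (+ b) s)
    where
    distrib : ∀ x y s → (x ℤ.+ y) ℤ.* (s ℤ.* s) ≡ (x ℤ.* s ℤ.+ y ℤ.* s) ℤ.* s
    distrib = ℤ-Solver.solve-∀

1+[x/1]*inv[d]≡[x+d]/d : ∀ (x : ℤ) d .{{_ : NonZero d}} → 1ℚ +ℚ (x / 1) *ℚ inv d ≡ (x ℤ.+ + d) / d
1+[x/1]*inv[d]≡[x+d]/d x (suc d) = begin
  1ℚ +ℚ (x / 1) *ℚ (+ 1 / suc d)
    ≡⟨ cong (1ℚ +ℚ_) (fromℚᵘ-homo-* (mkℚᵘ x 0) (mkℚᵘ (+ 1) d)) ⟨
  1ℚ +ℚ fromℚᵘ (mkℚᵘ x 0 ℚᵘ.* mkℚᵘ (+ 1) d)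
    ≡⟨ fromℚᵘ-homo-+ ℚᵘ.1ℚᵘ (mkℚᵘ x 0 ℚᵘ.* mkℚᵘ (+ 1) d) ⟨
  fromℚᵘ (ℚᵘ.1ℚᵘ ℚᵘ.+ mkℚᵘ x 0 ℚᵘ.* mkℚᵘ (+ 1) d)
    ≡⟨ ℚ.fromℚᵘ-cong {ℚᵘ.1ℚᵘ ℚᵘ.+ mkℚᵘ x 0 ℚᵘ.* mkℚᵘ (+ 1) d} {mkℚᵘ (x ℤ.+ + suc d) d}
                     (*≡* (identity x (+ suc d))) ⟩
  (x ℤ.+ + suc d) / suc d
    ∎
  where
  open ≡-Reasoning
  identity : ∀ x s → (+ 1 ℤ.* (+ 1 ℤ.* s) ℤ.+ (x ℤ.* + 1) ℤ.* + 1) ℤ.* s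
                   ≡ (x ℤ.+ s) ℤ.* (+ 1 ℤ.* (+ 1 ℤ.* s))
  identity = ℤ-Solver.solve-∀

inv≡1/ : ∀ c .{{_ : NonZero c}} → inv c ≡ + 1 / c
inv≡1/ (suc c) = refl

×ℚ-inv : ∀ m c .{{_ : NonZero c}} → m ×ℚ inv c ≡ + m / c
×ℚ-inv zero    c = sym (ℚ.0/n≡0 c)
×ℚ-inv (suc m) c = begin
  inv c +ℚ m ×ℚ inv c     ≡⟨ cong₂ _+ℚ_ (inv≡1/ c) (×ℚ-inv m c) ⟩
  + 1 / c +ℚ + m / c      ≡⟨ +-distrib-/ 1 m c ⟨
  + suc m / c             ∎
  where open ≡-Reasoning

inv-antitone : ∀ {m n} → 0 < m → m ≤ n → inv n ≤ℚ inv m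
inv-antitone {suc m} {suc n} _ m≤n = /-≤-cross {1} {1} {suc n} {suc m} (*-monoʳ-≤ 1 m≤n)

Φ-term : (n k i : ℕ) → ℚ
Φ-term n k i = inv ((n ∸ i) C (k ∸ i))

Φ-term-mono-≤ : ∀ {n k i j} → k ≤ n → i ≤ j → Φ-term n k i ≤ℚ Φ-term n k j
Φ-term-mono-≤ {j = j} k≤n i≤j =
  inv-antitone (0<nCk (∸-monoˡ-≤ j k≤n)) ([n∸j]C[k∸j]≤[n∸i]C[k∸i] k≤n i≤j)

iF-glb : ∀ {n l} (F : Family n) A → l ≤ n → All (λ B → l ≤ ∣ A ∩ B ∣) F → l ≤ iF F A
iF-glb []      A l≤n All.[]         = l≤n
iF-glb (B ∷ F) A l≤n (l≤A∩B All.∷ hs) = ⊓-glb l≤A∩B (iF-glb F A l≤n hs)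

inJ : (n k t : ℕ) → Subset n → Bool
inJ n k t A = (∣ A ∣ ≡ᵇ k) ∧ (t <ᵇ ∣ A ∩ initSeg n (t + 2) ∣)

a∸1≤c : ∀ {a b c s} → a + b ≤ c + s → s ≤ suc b → a ∸ 1 ≤ c
a∸1≤c {a} {b} {c} {s} a+b≤c+s s≤1+b =
  ∸-monoˡ-≤ 1 (+-cancelʳ-≤ b a (suc c)
    (≤-trans a+b≤c+s (≤-trans (+-monoʳ-≤ c s≤1+b) (≤-reflexive (+-suc c b)))))

module _ {n k t : ℕ} (t+2≤n : t + 2 ≤ n) where

  ∣A∩[t+2]∣≤2+t : ∀ A → ∣ A ∩ initSeg n (t + 2) ∣ ≤ 2 + t
  ∣A∩[t+2]∣≤2+t A = ≤-trans (∣p∩q∣≤∣q∣ A (initSeg n (t + 2)))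
                            (≤-reflexive (trans (∣initSeg∣≡ t+2≤n) (+-comm t 2)))

  ∣A∩[t+2]∣∸1≤∣A∩B∣ : ∀ A B → T (inJ n k t B) → ∣ A ∩ initSeg n (t + 2) ∣ ∸ 1 ≤ ∣ A ∩ B ∣
  ∣A∩[t+2]∣∸1≤∣A∩B∣ A B B∈J = a∸1≤c {b = ∣ B ∩ S ∣}
    (subst (λ s → ∣ A ∩ S ∣ + ∣ B ∩ S ∣ ≤ ∣ A ∩ B ∣ + s) (∣initSeg∣≡ t+2≤n) (∣p∩r∣+∣q∩r∣≤∣p∩q∣+∣r∣ A B S))
    (subst (_≤ suc ∣ B ∩ S ∣) (+-comm 2 t) (s≤s (<ᵇ⇒< t ∣ B ∩ S ∣ (proj₂ (Equivalence.to T-∧ B∈J)))))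
    where
    S = initSeg n (t + 2)

  ∣A∩[t+2]∣∸1≤iF : ∀ A → ∣ A ∩ initSeg n (t + 2) ∣ ∸ 1 ≤ iF (J n k t) A
  ∣A∩[t+2]∣∸1≤iF A = iF-glb (J n k t) A
    (≤-trans (m∸n≤m _ 1) (∣p∣≤n (A ∩ initSeg n (t + 2))))
    (All.map (λ {B} → ∣A∩[t+2]∣∸1≤∣A∩B∣ A B) (all-filter (T? ∘ inJ n k t) (allSubsets n)))

  sum-J≤Φ : k ≤ n → sumℚ (λ A → Φ-term n k (∣ A ∩ initSeg n (t + 2) ∣ ∸ 1)) (J n k t) ≤ℚ Φ n k (J n k t)
  sum-J≤Φ k≤n = sumℚ-mono-≤ (λ A → Φ-term-mono-≤ k≤n (∣A∩[t+2]∣∸1≤iF A)) (J n k t)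

  sum-J≡ : sumℚ (λ A → Φ-term n k (∣ A ∩ initSeg n (t + 2) ∣ ∸ 1)) (J n k t)
           ≡ count (hasSizeTrace (t + 2) k (2 + t)) (allSubsets n) ×ℚ Φ-term n k (suc t)
             +ℚ count (hasSizeTrace (t + 2) k (1 + t)) (allSubsets n) ×ℚ Φ-term n k t
  sum-J≡ = sumℚ-filter-top-two (λ A → ∣ A ∣ ≡ᵇ k) (λ A → ∣ A ∩ initSeg n (t + 2) ∣)
                               (λ a → Φ-term n k (a ∸ 1)) t ∣A∩[t+2]∣≤2+t (allSubsets n)

r*[w-r]+d≡e : ∀ {e r w d} → e + r * r ≡ r * w + d → + r *ℤ (+ w -ℤ + r) ℤ.+ + d ≡ + e
r*[w-r]+d≡e {e} {r} {w} {d} e+r²≡rw+d = begin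
  + r *ℤ (+ w -ℤ + r) ℤ.+ + d        ≡⟨ expand (+ r) (+ w) (+ d) ⟩
  (+ r *ℤ + w ℤ.+ + d) -ℤ + r *ℤ + r ≡⟨ cong₂ (λ x y → (x ℤ.+ + d) -ℤ y) (ℤ.pos-* r w) (ℤ.pos-* r r) ⟨
  (+ (r * w) ℤ.+ + d) -ℤ + (r * r)   ≡⟨ cong (_-ℤ + (r * r)) (ℤ.pos-+ (r * w) d) ⟨
  + (r * w + d) -ℤ + (r * r)         ≡⟨ cong (λ x → + x -ℤ + (r * r)) e+r²≡rw+d ⟨
  + (e + r * r) -ℤ + (r * r)         ≡⟨ cong (_-ℤ + (r * r)) (ℤ.pos-+ e (r * r)) ⟩
  (+ e ℤ.+ + (r * r)) -ℤ + (r * r)   ≡⟨ cancel (+ e) (+ (r * r)) ⟩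
  + e                                ∎
  where
  open ≡-Reasoning
  expand : ∀ r w d → r *ℤ (w -ℤ r) ℤ.+ d ≡ (r *ℤ w ℤ.+ d) -ℤ r *ℤ r
  expand = ℤ-Solver.solve-∀
  cancel : ∀ x y → (x ℤ.+ y) -ℤ y ≡ x
  cancel = ℤ-Solver.solve-∀

-- E₁ / D and E₂ / D are the contributions of the members of J meeting [t+2]
-- in t + 2 and in t + 1 points.
module _ (t j r : ℕ) where

  private
    k = t + 2 + j
    n = k + r
    m = j + r
    D = (2 + m) * (1 + m)
    E₁ = (2 + m) * (1 + j)
    E₂ = (2 + t) * ((2 + j) * r)
    E = E₁ + E₂
    W = (2 + j) * (t + 1)

    t+2≤k : t + 2 ≤ k
    t+2≤k = m≤m+n (t + 2) j

    k≤n : k ≤ n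
    k≤n = m≤m+n k r

    t+2≤n : t + 2 ≤ n
    t+2≤n = ≤-trans t+2≤k k≤n

    k∸t≡2+j : k ∸ t ≡ 2 + j
    k∸t≡2+j = trans (cong (_∸ t) (+-assoc t 2 j)) (m+n∸m≡n t (2 + j))

    n∸t≡2+m : n ∸ t ≡ 2 + m
    n∸t≡2+m = trans (+-∸-comm r (≤-trans (m≤m+n t 2) t+2≤k)) (cong (_+ r) k∸t≡2+j)

    n∸[t+2]≡m : n ∸ (t + 2) ≡ m
    n∸[t+2]≡m = trans (+-∸-comm r t+2≤k) (cong (_+ r) (m+n∸m≡n (t + 2) j))

    ∸suc : ∀ x y {z} → x ∸ y ≡ suc z → x ∸ suc y ≡ z
    ∸suc x y eq = trans (sym (pred[m∸n]≡m∸[1+n] x y)) (cong pred eq)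

    instance
      [1+m]C[1+j]-nonZero : NonZero ((1 + m) C (1 + j))
      [1+m]C[1+j]-nonZero = >-nonZero (0<nCk (s≤s (m≤m+n j r)))
      [2+m]C[2+j]-nonZero : NonZero ((2 + m) C (2 + j))
      [2+m]C[2+j]-nonZero = >-nonZero (0<nCk (s≤s (s≤s (m≤m+n j r))))

    count-top : count (hasSizeTrace (t + 2) k (2 + t)) (allSubsets n) ≡ m C j
    count-top = begin
      count (hasSizeTrace (t + 2) k (2 + t)) (allSubsets n)
        ≡⟨ cong (λ c → count (hasSizeTrace (t + 2) (c + j) (2 + t)) (allSubsets n)) (+-comm t 2) ⟩
      count (hasSizeTrace (t + 2) (2 + t + j) (2 + t)) (allSubsets n)
        ≡⟨ count-hasSizeTrace n (t + 2) (2 + t) j t+2≤n ⟩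
      ((t + 2) C (2 + t)) * ((n ∸ (t + 2)) C j)
        ≡⟨ cong₂ (λ a b → a * (b C j)) (trans (cong (_C (2 + t)) (+-comm t 2)) (nCn≡1 (2 + t))) n∸[t+2]≡m ⟩
      1 * (m C j)
        ≡⟨ *-identityˡ (m C j) ⟩
      m C j
        ∎
      where open ≡-Reasoning

    count-next : count (hasSizeTrace (t + 2) k (1 + t)) (allSubsets n) ≡ (2 + t) * (m C (1 + j))
    count-next = begin
      count (hasSizeTrace (t + 2) k (1 + t)) (allSubsets n)
        ≡⟨ cong (λ c → count (hasSizeTrace (t + 2) c (1 + t)) (allSubsets n))
                (trans (cong (_+ j) (+-comm t 2)) (sym (+-suc (1 + t) j))) ⟩
      count (hasSizeTrace (t + 2) (1 + t + (1 + j)) (1 + t)) (allSubsets n)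
        ≡⟨ count-hasSizeTrace n (t + 2) (1 + t) (1 + j) t+2≤n ⟩
      ((t + 2) C (1 + t)) * ((n ∸ (t + 2)) C (1 + j))
        ≡⟨ cong₂ (λ a b → a * (b C (1 + j))) (trans (cong (_C (1 + t)) (+-comm t 2)) ([1+n]Cn≡1+n (1 + t)))
                 n∸[t+2]≡m ⟩
      (2 + t) * (m C (1 + j))
        ∎
      where open ≡-Reasoning

    Φ-term-top : Φ-term n k (suc t) ≡ inv ((1 + m) C (1 + j))
    Φ-term-top = cong inv (cong₂ _C_ (∸suc n t n∸t≡2+m) (∸suc k t k∸t≡2+j))

    Φ-term-next : Φ-term n k t ≡ inv ((2 + m) C (2 + j))
    Φ-term-next = cong inv (cong₂ _C_ n∸t≡2+m k∸t≡2+j)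

    top-cross : (m C j) * D ≡ E₁ * ((1 + m) C (1 + j))
    top-cross = begin
      (m C j) * ((2 + m) * (1 + m))                 ≡⟨ rearrange (m C j) (2 + m) (1 + m) ⟩
      (2 + m) * ((1 + m) * (m C j))                 ≡⟨ cong ((2 + m) *_) ([k+1]*[n+1]C[k+1]≡[n+1]*nCk m j) ⟨
      (2 + m) * ((1 + j) * ((1 + m) C (1 + j)))     ≡⟨ *-assoc (2 + m) (1 + j) _ ⟨
      E₁ * ((1 + m) C (1 + j))                      ∎
      where
      open ≡-Reasoning
      rearrange : ∀ x a b → x * (a * b) ≡ a * (b * x)
      rearrange = ℕ-Solver.solve-∀

    next-cross : ((2 + t) * (m C (1 + j))) * D ≡ E₂ * ((2 + m) C (2 + j))
    next-cross = begin
      ((2 + t) * x) * ((2 + m) * (1 + m))           ≡⟨ rearrange₁ (2 + t) x (2 + m) (1 + m) ⟩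
      (2 + t) * ((2 + m) * ((1 + m) * x))           ≡⟨ cong (λ z → (2 + t) * ((2 + m) * z))
                                                            ([n+1]*nC[k+1]≡[n∸k]*[n+1]C[k+1] m j) ⟩
      (2 + t) * ((2 + m) * ((m ∸ j) * y))           ≡⟨ cong (λ z → (2 + t) * ((2 + m) * (z * y))) (m+n∸m≡n j r) ⟩
      (2 + t) * ((2 + m) * (r * y))                 ≡⟨ rearrange₂ (2 + t) (2 + m) r y ⟩
      (2 + t) * (r * ((2 + m) * y))                 ≡⟨ cong (λ z → (2 + t) * (r * z))
                                                            ([k+1]*[n+1]C[k+1]≡[n+1]*nCk (1 + m) (1 + j)) ⟨
      (2 + t) * (r * ((2 + j) * z))                 ≡⟨ rearrange₃ (2 + t) r (2 + j) z ⟩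
      E₂ * z                                        ∎
      where
      open ≡-Reasoning
      x = m C (1 + j)
      y = (1 + m) C (1 + j)
      z = (2 + m) C (2 + j)
      rearrange₁ : ∀ a x b c → (a * x) * (b * c) ≡ a * (b * (c * x))
      rearrange₁ = ℕ-Solver.solve-∀
      rearrange₂ : ∀ a b r y → a * (b * (r * y)) ≡ a * (r * (b * y))
      rearrange₂ = ℕ-Solver.solve-∀
      rearrange₃ : ∀ a r b z → a * (r * (b * z)) ≡ (a * (b * r)) * z
      rearrange₃ = ℕ-Solver.solve-∀

    sum-J≡E/D : sumℚ (λ A → Φ-term n k (∣ A ∩ initSeg n (t + 2) ∣ ∸ 1)) (J n k t) ≡ + E / D
    sum-J≡E/D = begin
      sumℚ (λ A → Φ-term n k (∣ A ∩ initSeg n (t + 2) ∣ ∸ 1)) (J n k t)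
        ≡⟨ sum-J≡ t+2≤n ⟩
      count (hasSizeTrace (t + 2) k (2 + t)) (allSubsets n) ×ℚ Φ-term n k (suc t)
        +ℚ count (hasSizeTrace (t + 2) k (1 + t)) (allSubsets n) ×ℚ Φ-term n k t
        ≡⟨ cong₂ _+ℚ_ (cong₂ _×ℚ_ count-top Φ-term-top) (cong₂ _×ℚ_ count-next Φ-term-next) ⟩
      (m C j) ×ℚ inv ((1 + m) C (1 + j)) +ℚ ((2 + t) * (m C (1 + j))) ×ℚ inv ((2 + m) C (2 + j))
        ≡⟨ cong₂ _+ℚ_ (×ℚ-inv (m C j) ((1 + m) C (1 + j)))
                      (×ℚ-inv ((2 + t) * (m C (1 + j))) ((2 + m) C (2 + j))) ⟩
      + (m C j) / ((1 + m) C (1 + j)) +ℚ + ((2 + t) * (m C (1 + j))) / ((2 + m) C (2 + j))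
        ≡⟨ cong₂ _+ℚ_ (/-cong-cross {m C j} {E₁} {(1 + m) C (1 + j)} {D} top-cross)
                      (/-cong-cross {(2 + t) * (m C (1 + j))} {E₂} {(2 + m) C (2 + j)} {D} next-cross) ⟩
      + E₁ / D +ℚ + E₂ / D
        ≡⟨ +-distrib-/ E₁ E₂ D ⟨
      + E / D
        ∎
      where open ≡-Reasoning

    E+r²≡rW+D : E + r * r ≡ r * W + D
    E+r²≡rW+D = identity j r t
      where
      identity : ∀ j r t → ((2 + (j + r)) * (1 + j) + (2 + t) * ((2 + j) * r)) + r * r
                           ≡ r * ((2 + j) * (t + 1)) + (2 + (j + r)) * (1 + (j + r))
      identity = ℕ-Solver.solve-∀

    D<E : 0 < r → r < W → D < E
    D<E 0<r r<W = +-cancelʳ-< (r * r) D E (begin-strict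
      D + r * r    <⟨ +-monoʳ-< D (*-monoʳ-< r {{>-nonZero 0<r}} r<W) ⟩
      D + r * W    ≡⟨ +-comm D (r * W) ⟩
      r * W + D    ≡⟨ E+r²≡rW+D ⟨
      E + r * r    ∎)
      where open ≤-Reasoning

  bound≡E/D : 1ℚ +ℚ ((((+ (n ∸ k)) *ℤ ((+ ((k ∸ t) * (t + 1))) -ℤ (+ (n ∸ k)))) / 1)
                *ℚ inv ((n ∸ t) * (n ∸ t ∸ 1)))
              ≡ + E / D
  bound≡E/D = begin
    bound (n ∸ k) (k ∸ t) (n ∸ t)   ≡⟨ cong₂ (λ x y → bound x y (n ∸ t)) (m+n∸m≡n k r) k∸t≡2+j ⟩
    bound r (2 + j) (n ∸ t)         ≡⟨ cong (bound r (2 + j)) n∸t≡2+m ⟩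
    bound r (2 + j) (2 + m)         ≡⟨ 1+[x/1]*inv[d]≡[x+d]/d (+ r *ℤ (+ W -ℤ + r)) D ⟩
    (+ r *ℤ (+ W -ℤ + r) ℤ.+ + D) / D ≡⟨ cong (_/ D) (r*[w-r]+d≡e {E} {r} {W} {D} E+r²≡rW+D) ⟩
    + E / D                 ∎
    where
    open ≡-Reasoning
    bound : ℕ → ℕ → ℕ → ℚ
    bound x y z = 1ℚ +ℚ ((((+ x) *ℤ ((+ (y * (t + 1))) -ℤ (+ x))) / 1) *ℚ inv (z * (z ∸ 1)))

  E/D≤Φ : + E / D ≤ℚ Φ n k (J n k t)
  E/D≤Φ = subst (_≤ℚ Φ n k (J n k t)) sum-J≡E/D (sum-J≤Φ t+2≤n k≤n)

  1<E/D : k < n → n < k + (k ∸ t) * (t + 1) → 1ℚ <ℚ + E / D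
  1<E/D k<n n<k+[k∸t][t+1] = /-<-cross {1} {E} {1} {D}
    (subst₂ _<_ (sym (*-identityˡ D)) (sym (*-identityʳ E)) (D<E 0<r r<W))
    where
    0<r : 0 < r
    0<r = subst (0 <_) (m+n∸m≡n k r) (m<n⇒0<n∸m k<n)
    r<W : r < W
    r<W = subst (λ x → r < x * (t + 1)) k∸t≡2+j (+-cancelˡ-< k r _ n<k+[k∸t][t+1])

proposition6p1 : (n k t : ℕ) → k ≤ n → 1 ≤ t → t + 2 ≤ k →
    (1ℚ +ℚ ((((+ (n ∸ k)) *ℤ ((+ ((k ∸ t) * (t + 1))) -ℤ (+ (n ∸ k)))) / 1)
              *ℚ inv ((n ∸ t) * (n ∸ t ∸ 1)))
      ≤ℚ Φ n k (J n k t))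
    × (k < n → n < k + (k ∸ t) * (t + 1) → 1ℚ <ℚ Φ n k (J n k t))
proposition6p1 n k t k≤n _ t+2≤k with m≤n⇒∃[o]m+o≡n t+2≤k
... | j , refl with m≤n⇒∃[o]m+o≡n k≤n
... | r , refl =
  ℚ.≤-trans (ℚ.≤-reflexive (bound≡E/D t j r)) (E/D≤Φ t j r) ,
  λ k<n n<k+[k∸t][t+1] → ℚ.<-≤-trans (1<E/D t j r k<n n<k+[k∸t][t+1]) (E/D≤Φ t j r)
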